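{- Let $(G,*)$ be a groupoid satisfying the identities (i) $x(yz)\approx x(zy)\approx y(xz)$ and (ii) $w(x(yz))\approx w((xy)z)$. Then $s_n(*)\le n-1$ for $n=2,3,\dots$ and $$s^{ac}_n(*)\le n!+\sum_{k=0}^{n-3} n(n-1)\cdots(n-k+1)=n!+\sum_{k=0}^{n-3}k!\binom nk$$ for $n=1,2,\dots$. The first inequality holds as an equality whenever the second does, and both equalities hold for the 3-element groupoids $\mathrm{SC}367$ (rows $0{:}\ 0\,0\,1$; $1{:}\ 0\,0\,0$; $2{:}\ 0\,0\,0$) and $\mathrm{SC}10$ (rows $0{:}\ 0\,0\,0$; $1{:}\ 0\,0\,0$; $2{:}\ 1\,0\,0$).
   Context: A groupoid $(G,*)$ is a set with a binary operation; $xy$ denotes $x*y$. $\mathcal B_n$ is the set of bracketings of the word $x_1x_2\cdots x_n$ (all ways to insert parentheses), and $\mathcal F_n$ is the set of full linear terms, obtained from bracketings by permuting the variables. Each such term $t$ induces an $n$-ary operation $t^*$ on $G$. The associative spectrum is $s_n(*):=|\{t^*:t\in\mathcal B_n\}|$ and the associative-commutative spectrum is $s^{ac}_n(*):=|\{t^*:t\in\mathcal F_n\}|$. A groupoid satisfies an identity if both sides take equal values under every assignment of elements of $G$ to the variables. A 3-element groupoid on $\{0,1,2\}$ is given by its Cayley table; "row $a{:}\ p\,q\,r$" means $a*0=p$, $a*1=q$, $a*2=r$. -}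

module Defs where

open import Data.Nat using (ℕ; zero; suc; _+_; _*_; _∸_; _≤_; _!)
open import Data.Nat.Combinatorics using (_P_)
open import Data.Fin using (Fin; zero; suc)
open import Data.List using (List; []; _∷_; _++_; length; allFin; upTo; map)
open import Data.Nat.ListAction using (sum)
open import Data.List.Relation.Unary.All using (All)
open import Data.List.Relation.Unary.Any using (Any)
open import Data.List.Relation.Unary.AllPairs using (AllPairs)
open import Data.List.Relation.Binary.Permutation.Propositional using (_↭_)
open import Data.Product using (Σ; _×_)
open import Relation.Binary.PropositionalEquality using (_≡_)
open import Relation.Nullary using (¬_)

data Term (V : Set) : Set where
  var  : V → Term V
  _·_  : Term V → Term V → Term V

leaves : {V : Set} → Term V → List V
leaves (var v) = v ∷ []
leaves (s · t) = leaves s ++ leaves t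

IsBracketing : (n : ℕ) → Term (Fin n) → Set
IsBracketing n t = leaves t ≡ allFin n

IsFullLinear : (n : ℕ) → Term (Fin n) → Set
IsFullLinear n t = leaves t ↭ allFin n

eval : {G : Set} → (G → G → G) → {n : ℕ} → (Fin n → G) → Term (Fin n) → G
eval _∙_ ρ (var i) = ρ i
eval _∙_ ρ (s · t) = eval _∙_ ρ s ∙ eval _∙_ ρ t

SameOp : {G : Set} → (G → G → G) → {n : ℕ} → Term (Fin n) → Term (Fin n) → Set
SameOp {G} _∙_ {n} s t = (ρ : Fin n → G) → eval _∙_ ρ s ≡ eval _∙_ ρ t

-- |{ t* : t ∈ Q }| ≤ k : at most k terms from Q induce all operations t*, t ∈ Q.
SpecAtMost : {G : Set} → (G → G → G) → {n : ℕ} → (Term (Fin n) → Set) → ℕ → Set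
SpecAtMost _∙_ {n} Q k =
  Σ (List (Term (Fin n))) λ L →
    All Q L × length L ≤ k × ((t : Term (Fin n)) → Q t → Any (SameOp _∙_ t) L)

-- |{ t* : t ∈ Q }| = k : there are k terms from Q inducing pairwise distinct
-- operations, and every t* (t ∈ Q) is one of them.
SpecIs : {G : Set} → (G → G → G) → {n : ℕ} → (Term (Fin n) → Set) → ℕ → Set
SpecIs _∙_ {n} Q k =
  Σ (List (Term (Fin n))) λ L →
    All Q L × length L ≡ k
    × AllPairs (λ s t → ¬ SameOp _∙_ s t) L
    × ((t : Term (Fin n)) → Q t → Any (SameOp _∙_ t) L)

sAtMost : {G : Set} → (G → G → G) → ℕ → ℕ → Set
sAtMost _∙_ n k = SpecAtMost _∙_ (IsBracketing n) k

sIs : {G : Set} → (G → G → G) → ℕ → ℕ → Set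
sIs _∙_ n k = SpecIs _∙_ (IsBracketing n) k

sacAtMost : {G : Set} → (G → G → G) → ℕ → ℕ → Set
sacAtMost _∙_ n k = SpecAtMost _∙_ (IsFullLinear n) k

sacIs : {G : Set} → (G → G → G) → ℕ → ℕ → Set
sacIs _∙_ n k = SpecIs _∙_ (IsFullLinear n) k

-- n! + Σ_{k=0}^{n-3} n(n-1)⋯(n-k+1)   (empty sum for n < 3)
acBound : ℕ → ℕ
acBound n = n ! + sum (map (λ k → n P k) (upTo (n ∸ 2)))

IdentityI : {G : Set} → (G → G → G) → Set
IdentityI {G} _∙_ = (x y z : G) →
  (x ∙ (y ∙ z) ≡ x ∙ (z ∙ y)) × (x ∙ (z ∙ y) ≡ y ∙ (x ∙ z))

IdentityII : {G : Set} → (G → G → G) → Set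
IdentityII {G} _∙_ = (w x y z : G) → w ∙ (x ∙ (y ∙ z)) ≡ w ∙ ((x ∙ y) ∙ z)

sc367 : Fin 3 → Fin 3 → Fin 3
sc367 zero (suc (suc zero)) = suc zero
sc367 _ _ = zero

sc10 : Fin 3 → Fin 3 → Fin 3
sc10 (suc (suc zero)) zero = suc zero
sc10 _ _ = zero

-- Identity (i) gives w(xy) = w(yx) and x(yz) = y(xz). Write a term as its core (a variable, or a
-- product u(vw) whose right factor is compound) followed by trailing variables applied one at a
-- time. By induction on size, (i) makes the value of a core with at least three leaves equal to
-- that of the right comb x₁(x₂(⋯xₖ)) over its leaves taken in any order. So the operation of a full
-- linear term depends only on its trailing sequence zs: an injective sequence of length k with
-- n − k = 1 or n − k ≥ 3, of which there are n! + Σ_{k ≤ n−3} n(n−1)⋯(n−k+1); for a bracketing zs is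
-- fixed by its length, leaving n − 1 possibilities.
--
-- In SC367 two such normal forms are separated by giving the outermost trailing variable where they
-- differ the value 2 and every other variable 0, so both bounds are attained. If s^ac is attained,
-- no two normal forms agree, in particular none of the n − 1 for bracketings. SC10 is the opposite
-- groupoid of SC367, and mirroring terms (reversing them and renaming xᵢ to x₍ₙ₊₁₋ᵢ₎) transfers the
-- spectra.

module Submission where

open import Defs
open import Data.Nat using (ℕ; zero; suc; pred; _+_; _*_; _∸_; _⊓_; _≤_; _<_; z≤n; s≤s; _!; _≤ᵇ_; _≤?_)
open import Data.Nat.Properties
open import Data.Nat.Combinatorics using (_P_; k>n⇒nPk≡0)
open import Data.Nat.Combinatorics.Base using (_P′_)
open import Data.Nat.Combinatorics.Specification using (nP′k≡n[n∸1P′k∸1])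
open import Data.Bool using (true; false; T)
open import Data.Fin using (Fin; zero; suc; opposite; fromℕ; inject₁)
open import Data.Fin.Properties using (opposite-involutive)
import Data.Fin
open import Data.Vec.Functional using (updateAt)
open import Data.Vec.Functional.Properties using (updateAt-updates; updateAt-minimal)
open import Data.List
  using (List; []; _∷_; _++_; _∷ʳ_; length; reverse; map; concatMap; take; drop; upTo; allFin; tabulate)
open import Data.Nat.ListAction using (sum)
open import Data.List.Properties
  using (++-assoc; ++-identityʳ; length-++; length-++-≤ˡ; length-++-≤ʳ; length-++-comm; length-map;
         length-removeAt′; length-tabulate; length-upTo; length-take; length-drop; length-reverse; map-cong;
         map-++; map-tabulate; reverse-involutive; reverse-++; reverse-map; unfold-reverse; take++drop≡id;
         ∷-injectiveˡ; ∷-injectiveʳ)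
open import Data.List.Relation.Unary.All as All using (All; []; _∷_)
import Data.List.Relation.Unary.All.Properties as All
import Data.List.Relation.Unary.Any.Properties as Any
open import Data.List.Relation.Unary.Any as Any using (Any; here; there; _─_)
open import Data.List.Relation.Unary.AllPairs as AllPairs using (AllPairs; []; _∷_)
import Data.List.Relation.Unary.AllPairs.Properties as AllPairs
open import Data.List.Relation.Unary.Unique.Propositional using (Unique)
open import Data.List.Relation.Unary.Unique.Propositional.Properties using (upTo⁺; allFin⁺)
open import Data.List.Membership.Propositional using (_∈_; find; lose)
open import Data.List.Membership.Propositional.Properties
  using (∈-map⁺; ∈-map⁻; ∈-concatMap⁺; ∈-concatMap⁻; ∈-upTo⁺; ∈-upTo⁻)
open import Data.List.Relation.Binary.Permutation.Propositional as ↭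
  using (_↭_; prep; swap; ↭-refl; ↭-sym; ↭-trans; ↭-reflexive; ↭⇒↭ₛ)
open import Data.List.Relation.Binary.Permutation.Propositional.Properties
  using (↭-length; ↭-empty-inv; ↭-singleton-inv; shift; drop-∷; ∈-resp-↭; ∷↭∷ʳ; ++-comm; ++⁺ˡ; ↭-reverse)
import Data.List.Relation.Binary.Permutation.Propositional.Properties as ↭ₚ
import Data.List.Relation.Binary.Permutation.Setoid.Properties as ↭ₛ
open import Data.Product using (Σ; _×_; _,_; proj₁; proj₂; map₁; map₂)
open import Data.Sum using (_⊎_; inj₁; inj₂)
import Data.Sum as Sum
open import Data.Empty using (⊥-elim)
open import Function using (_∘_)
open import Relation.Binary.PropositionalEquality
  using (_≡_; _≢_; refl; sym; trans; cong; cong₂; subst; subst₂; setoid; module ≡-Reasoning)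
open import Relation.Nullary using (¬_; yes; no; contradiction)

module _ {A B : Set} where

  length-concatMap-const : ∀ (f : A → List B) xs c → (∀ {x} → x ∈ xs → length (f x) ≡ c) →
                           length (concatMap f xs) ≡ length xs * c
  length-concatMap-const f []       c h = refl
  length-concatMap-const f (x ∷ xs) c h =
    trans (length-++ (f x)) (cong₂ _+_ (h (here refl)) (length-concatMap-const f xs c (h ∘ there)))

  AllPairs-concatMap⁺ : ∀ {R : B → B → Set} (f : A → List B) {xs} →
                        All (AllPairs R ∘ f) xs →
                        AllPairs (λ x y → ∀ {u v} → u ∈ f x → v ∈ f y → R u v) xs →
                        AllPairs R (concatMap f xs)
  AllPairs-concatMap⁺ f inner outer =
    AllPairs.concat⁺ (All.map⁺ inner)
      (AllPairs.map⁺ (AllPairs.map (λ Rxy → All.tabulate λ u∈ → All.tabulate λ v∈ → Rxy u∈ v∈) outer))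

  length-concatMap : ∀ (f : A → List B) xs → length (concatMap f xs) ≡ sum (map (length ∘ f) xs)
  length-concatMap f []       = refl
  length-concatMap f (x ∷ xs) = trans (length-++ (f x)) (cong (length (f x) +_) (length-concatMap f xs))

module _ {A : Set} where

  Unique-resp-↭ : ∀ {xs ys : List A} → xs ↭ ys → Unique xs → Unique ys
  Unique-resp-↭ p = ↭ₛ.Unique-resp-↭ (setoid A) (↭⇒↭ₛ p)

  take-length-++ : ∀ (xs ys : List A) → take (length xs) (xs ++ ys) ≡ xs
  take-length-++ []       ys = refl
  take-length-++ (x ∷ xs) ys = cong (x ∷_) (take-length-++ xs ys)

  drop-length-++ : ∀ (xs ys : List A) → drop (length xs) (xs ++ ys) ≡ ys
  drop-length-++ []       ys = refl
  drop-length-++ (x ∷ xs) ys = drop-length-++ xs ys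

  Unique-∷ʳ⁻ : ∀ {xs : List A} {z} → Unique (xs ∷ʳ z) → All (z ≢_) xs × Unique xs
  Unique-∷ʳ⁻ {xs} {z} uniq with Unique-resp-↭ (↭-sym (∷↭∷ʳ z xs)) uniq
  ... | z∉xs ∷ uniq′ = z∉xs , uniq′

  AllPairs-strengthen : ∀ {Q : A → Set} {R S : A → A → Set} → (∀ {a b} → Q a → Q b → R a b → S a b) →
                        ∀ {xs} → All Q xs → AllPairs R xs → AllPairs S xs
  AllPairs-strengthen f []         []         = []
  AllPairs-strengthen f (pa ∷ pxs) (ra ∷ rxs) =
    All.zipWith (λ (pb , r) → f pa pb r) (pxs , ra) ∷ AllPairs-strengthen f pxs rxs

module _ {A : Set} {R S : A → Set} where

  Any-─ : ∀ {xs} (p : Any R xs) → Any S xs → Any S (xs ─ p) ⊎ Σ A (λ x → R x × S x)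
  Any-─ (here px) (here qx) = inj₂ (_ , px , qx)
  Any-─ (here px) (there q) = inj₁ q
  Any-─ (there p) (here qx) = inj₁ (here qx)
  Any-─ (there p) (there q) = Sum.map₁ there (Any-─ p q)

module Covering {A : Set} (_≈_ : A → A → Set)
                (≈-sym : ∀ {a b} → a ≈ b → b ≈ a) (≈-trans : ∀ {a b c} → a ≈ b → b ≈ c → a ≈ c) where

  Inequivalent : List A → Set
  Inequivalent = AllPairs (λ a b → ¬ a ≈ b)

  CoveredBy : List A → List A → Set
  CoveredBy ys = All (λ x → Any (x ≈_) ys)

  covered-length≤ : ∀ {xs ys} → Inequivalent xs → CoveredBy ys xs → length xs ≤ length ys
  covered-length≤ {[]}     []         []             = z≤n
  covered-length≤ {x ∷ xs} {ys} (x≉xs ∷ ineq) (x≈y ∷ cover) =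
    subst (suc (length xs) ≤_) (sym (length-removeAt′ ys (Any.index x≈y)))
      (s≤s (covered-length≤ ineq (still-covered x≉xs cover)))
    where
      still-covered : ∀ {zs} → All (λ z → ¬ x ≈ z) zs → CoveredBy ys zs → CoveredBy (ys ─ x≈y) zs
      still-covered []           []             = []
      still-covered (x≉z ∷ x≉zs) (z≈w ∷ cover′) with Any-─ x≈y z≈w
      ... | inj₁ z≈w′             = z≈w′ ∷ still-covered x≉zs cover′
      ... | inj₂ (_ , x≈y′ , z≈y′) = ⊥-elim (x≉z (≈-trans x≈y′ (≈-sym z≈y′)))

  tight-cover-inequivalent : ∀ {xs ys} → Inequivalent xs → CoveredBy ys xs → length ys ≤ length xs →
                             ∀ {y y′} → y ∈ ys → y′ ∈ ys → y ≢ y′ → ¬ y ≈ y′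
  tight-cover-inequivalent {xs} {ys} ineq cover ys≤xs {y} {y′} y∈ y′∈ y≢y′ y≈y′ =
    1+n≰n (≤-trans (≤-reflexive (sym (length-removeAt′ ys (Any.index y∈))))
                   (≤-trans ys≤xs (covered-length≤ ineq (All.map reroute cover))))
    where
      y′∈rest : y′ ∈ (ys ─ y∈)
      y′∈rest with Any-─ y∈ y′∈
      ... | inj₁ y′∈′               = y′∈′
      ... | inj₂ (_ , refl , refl) = ⊥-elim (y≢y′ refl)
      reroute : ∀ {x} → Any (x ≈_) ys → Any (x ≈_) (ys ─ y∈)
      reroute x≈w with Any-─ y∈ x≈w
      ... | inj₁ x≈w′             = x≈w′
      ... | inj₂ (_ , refl , x≈y) = Any.map (λ { refl → ≈-trans x≈y y≈y′ }) y′∈rest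

P≡P′ : ∀ {n k} → k ≤ n → n P k ≡ n P′ k
P≡P′ {n} {k} k≤n with k ≤ᵇ n in eq
... | true  = refl
... | false = contradiction (≤⇒≤ᵇ k≤n) (subst T eq)

suc-P-suc : ∀ n k → suc n P suc k ≡ suc n * (n P k)
suc-P-suc n k with k ≤? n
... | yes k≤n = trans (P≡P′ (s≤s k≤n))
                  (trans (nP′k≡n[n∸1P′k∸1] (suc n) (suc k)) (cong (suc n *_) (sym (P≡P′ k≤n))))
... | no k≰n  = trans (k>n⇒nPk≡0 (s≤s (≰⇒> k≰n)))
                  (sym (trans (cong (suc n *_) (k>n⇒nPk≡0 (≰⇒> k≰n))) (*-zeroʳ (suc n))))

suc-P≡! : ∀ m → suc m P m ≡ suc m !
suc-P≡! zero    = refl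
suc-P≡! (suc m) = trans (suc-P-suc (suc m) m) (cong (suc (suc m) *_) (suc-P≡! m))

k<m∸1⇒3≤r : ∀ m k r → r + k ≡ suc m → k < m ∸ 1 → 3 ≤ r
k<m∸1⇒3≤r (suc (suc m)) zero    r eq _ =
  ≤-trans (s≤s (s≤s (s≤s z≤n))) (≤-reflexive (sym (trans (sym (+-identityʳ r)) eq)))
k<m∸1⇒3≤r (suc (suc m)) (suc k) r eq (s≤s k<) =
  k<m∸1⇒3≤r (suc m) k r (suc-injective (trans (sym (+-suc r k)) eq)) k<

3≤r⇒k<m∸1 : ∀ m k r → r + k ≡ suc m → 3 ≤ r → k < m ∸ 1
3≤r⇒k<m∸1 m k (suc (suc (suc r))) eq _ with refl ← suc-injective eq = s≤s (m≤n+m k r)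
3≤r⇒k<m∸1 m k (suc zero)       eq (s≤s ())
3≤r⇒k<m∸1 m k (suc (suc zero)) eq (s≤s (s≤s ()))

j<m∸1⇒3+j≤1+m : ∀ m {j} → j < m ∸ 1 → 3 + j ≤ suc m
j<m∸1⇒3+j≤1+m (suc m) j< = s≤s (s≤s j<)

-- Injective sequences

module _ {A : Set} where

  select : List A → List (A × List A)
  select []       = []
  select (x ∷ xs) = (x , xs) ∷ map (map₂ (x ∷_)) (select xs)

  select-↭ : ∀ xs {y ys} → (y , ys) ∈ select xs → xs ↭ y ∷ ys
  select-↭ (x ∷ xs) (here refl) = ↭-refl
  select-↭ (x ∷ xs) (there p) with ∈-map⁻ (map₂ (x ∷_)) p
  ... | (y , ys) , q , refl = ↭-trans (prep x (select-↭ xs q)) (swap x y ↭-refl)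

  ∈-select : ∀ {xs y} → y ∈ xs → Σ (List A) λ ys → (y , ys) ∈ select xs
  ∈-select {x ∷ xs} (here refl) = xs , here refl
  ∈-select {x ∷ xs} (there y∈) with ∈-select y∈
  ... | ys , p = x ∷ ys , there (∈-map⁺ (map₂ (x ∷_)) p)

  length-select : ∀ xs → length (select xs) ≡ length xs
  length-select []       = refl
  length-select (x ∷ xs) = cong suc (trans (length-map _ (select xs)) (length-select xs))

  select-distinct : ∀ {xs} → Unique xs → AllPairs (λ p q → proj₁ p ≢ proj₁ q) (select xs)
  select-distinct {[]}     []            = []
  select-distinct {x ∷ xs} (x∉xs ∷ uniq) =
    All.tabulate x≢ ∷ AllPairs.map⁺ (select-distinct uniq)
    where
      x≢ : ∀ {q} → q ∈ map (map₂ (x ∷_)) (select xs) → x ≢ proj₁ q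
      x≢ q∈ with ∈-map⁻ (map₂ (x ∷_)) q∈
      ... | _ , p , refl = All.lookup x∉xs (∈-resp-↭ (↭-sym (select-↭ xs p)) (here refl))

  mutual
    injSeqs : ℕ → List A → List (List A × List A)
    injSeqs zero    xs = ([] , xs) ∷ []
    injSeqs (suc k) xs = concatMap (injSeqsStartingWith k) (select xs)

    injSeqsStartingWith : ℕ → A × List A → List (List A × List A)
    injSeqsStartingWith k (y , ys) = map (map₁ (y ∷_)) (injSeqs k ys)

  length-injSeqs : ∀ k xs → length (injSeqs k xs) ≡ length xs P k
  length-injSeqs zero    xs       = refl
  length-injSeqs (suc k) []       = refl
  length-injSeqs (suc k) (x ∷ xs) =
    trans (length-concatMap-const (injSeqsStartingWith k) (select (x ∷ xs)) (length xs P k) each)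
          (trans (cong (_* (length xs P k)) (length-select (x ∷ xs))) (sym (suc-P-suc (length xs) k)))
    where
      each : ∀ {p} → p ∈ select (x ∷ xs) → length (injSeqsStartingWith k p) ≡ length xs P k
      each {y , ys} p = trans (length-map _ (injSeqs k ys))
        (trans (length-injSeqs k ys) (cong (λ l → l P k) (cong pred (sym (↭-length (select-↭ (x ∷ xs) p))))))

  injSeqs-sound : ∀ k xs {zs r} → (zs , r) ∈ injSeqs k xs → xs ↭ r ++ zs × length zs ≡ k
  injSeqs-sound zero    xs (here refl) = ↭-reflexive (sym (++-identityʳ xs)) , refl
  injSeqs-sound (suc k) xs p with find (∈-concatMap⁻ (injSeqsStartingWith k) {xs = select xs} p)
  ... | (y , ys) , s , q with ∈-map⁻ (map₁ (y ∷_)) q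
  ... | (zs , r) , q′ , refl with injSeqs-sound k ys q′
  ... | ys↭ , refl = ↭-trans (select-↭ xs s) (↭-trans (prep y ys↭) (↭-sym (shift y r zs))) , refl

  injSeqs-complete : ∀ zs {xs r} → xs ↭ r ++ zs →
                     Σ (List A) λ r′ → (zs , r′) ∈ injSeqs (length zs) xs × r′ ↭ r
  injSeqs-complete []       {xs} {r} p = xs , here refl , ↭-trans p (↭-reflexive (++-identityʳ r))
  injSeqs-complete (z ∷ zs) {xs} {r} p = extend (∈-select (∈-resp-↭ (↭-sym xs↭) (here refl)))
    where
      xs↭ : xs ↭ z ∷ r ++ zs
      xs↭ = ↭-trans p (shift z r zs)
      extend : Σ (List A) (λ ys → (z , ys) ∈ select xs) →
               Σ (List A) λ r′ → (z ∷ zs , r′) ∈ injSeqs (length (z ∷ zs)) xs × r′ ↭ r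
      extend (ys , s) with injSeqs-complete zs (drop-∷ (↭-trans (↭-sym (select-↭ xs s)) xs↭))
      ... | r′ , q , r′↭ =
        r′ , ∈-concatMap⁺ (injSeqsStartingWith (length zs)) (lose s (∈-map⁺ (map₁ (z ∷_)) q)) , r′↭

  injSeqs-distinct : ∀ k {xs} → Unique xs → AllPairs (λ p q → proj₁ p ≢ proj₁ q) (injSeqs k xs)
  injSeqs-distinct zero    uniq = [] ∷ []
  injSeqs-distinct (suc k) {xs} uniq =
    AllPairs-concatMap⁺ (injSeqsStartingWith k)
      (All.tabulate λ {p} s → AllPairs.map⁺
        (AllPairs.map (λ zs≢ eq → zs≢ (∷-injectiveʳ eq))
          (injSeqs-distinct k (tail-unique s))))
      (AllPairs.map heads≢ (select-distinct uniq))
    where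
      tail-unique : ∀ {y ys} → (y , ys) ∈ select xs → Unique ys
      tail-unique s with Unique-resp-↭ (select-↭ xs s) uniq
      ... | _ ∷ uniq′ = uniq′
      heads≢ : ∀ {p q} → proj₁ p ≢ proj₁ q → ∀ {u v} → u ∈ injSeqsStartingWith k p →
               v ∈ injSeqsStartingWith k q → proj₁ u ≢ proj₁ v
      heads≢ {p} {q} y≢ u∈ v∈ with ∈-map⁻ (map₁ (proj₁ p ∷_)) u∈ | ∈-map⁻ (map₁ (proj₁ q ∷_)) v∈
      ... | _ , _ , refl | _ , _ , refl = λ eq → y≢ (∷-injectiveˡ eq)

-- The possible leaf counts of a Core term.
Admissible : ℕ → Set
Admissible k = k ≡ 1 ⊎ 3 ≤ k

module _ {V : Set} where

  size : Term V → ℕ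
  size (var x) = 1
  size (a · b) = size a + size b

  size≡length-leaves : ∀ t → size t ≡ length (leaves t)
  size≡length-leaves (var x) = refl
  size≡length-leaves (a · b) =
    trans (cong₂ _+_ (size≡length-leaves a) (size≡length-leaves b)) (sym (length-++ (leaves a)))

  1≤size : ∀ t → 1 ≤ size t
  1≤size (var x) = s≤s z≤n
  1≤size (a · b) = ≤-trans (1≤size a) (m≤m+n (size a) (size b))

  1≤length-leaves : ∀ t → 1 ≤ length (leaves t)
  1≤length-leaves t = subst (1 ≤_) (size≡length-leaves t) (1≤size t)

  appendVars : Term V → List V → Term V
  appendVars u []       = u
  appendVars u (z ∷ zs) = appendVars u zs · var z

  leaves-appendVars : ∀ u zs → leaves (appendVars u zs) ≡ leaves u ++ reverse zs
  leaves-appendVars u [] = sym (++-identityʳ (leaves u))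
  leaves-appendVars u (z ∷ zs) = begin
    leaves (appendVars u zs) ++ z ∷ []  ≡⟨ cong (_++ z ∷ []) (leaves-appendVars u zs) ⟩
    (leaves u ++ reverse zs) ++ z ∷ []  ≡⟨ ++-assoc (leaves u) (reverse zs) (z ∷ []) ⟩
    leaves u ++ reverse zs ∷ʳ z         ≡⟨ cong (leaves u ++_) (unfold-reverse z zs) ⟨
    leaves u ++ reverse (z ∷ zs)        ∎
    where open ≡-Reasoning

  data Core : Term V → Set where
    var   : ∀ x → Core (var x)
    block : ∀ a b c → Core (a · (b · c))

  core : Term V → Term V
  core (var x)       = var x
  core (a · var y)   = core a
  core (a · (b · c)) = a · (b · c)

  trailing : Term V → List V
  trailing (var x)       = []
  trailing (a · var y)   = y ∷ trailing a
  trailing (a · (b · c)) = []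

  core-Core : ∀ t → Core (core t)
  core-Core (var x)       = var x
  core-Core (a · var y)   = core-Core a
  core-Core (a · (b · c)) = block a b c

  appendVars-core-trailing : ∀ t → appendVars (core t) (trailing t) ≡ t
  appendVars-core-trailing (var x)       = refl
  appendVars-core-trailing (a · var y)   = cong (_· var y) (appendVars-core-trailing a)
  appendVars-core-trailing (a · (b · c)) = refl

  trailing-appendVars : ∀ {u} → Core u → ∀ zs → trailing (appendVars u zs) ≡ zs
  trailing-appendVars (var x)       []       = refl
  trailing-appendVars (block a b c) []       = refl
  trailing-appendVars cu            (z ∷ zs) = cong (z ∷_) (trailing-appendVars cu zs)

  leaves-core-trailing : ∀ t → leaves t ≡ leaves (core t) ++ reverse (trailing t)
  leaves-core-trailing t =
    trans (cong leaves (sym (appendVars-core-trailing t))) (leaves-appendVars (core t) (trailing t))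

  3≤length-leaves-block : ∀ a b c → 3 ≤ length (leaves (a · (b · c)))
  3≤length-leaves-block a b c
    rewrite length-++ (leaves a) {leaves b ++ leaves c} | length-++ (leaves b) {leaves c} =
    +-mono-≤ (1≤length-leaves a) (+-mono-≤ (1≤length-leaves b) (1≤length-leaves c))

  length-leaves-Core : ∀ {u} → Core u → Admissible (length (leaves u))
  length-leaves-Core (var x)       = inj₁ refl
  length-leaves-Core (block a b c) = inj₂ (3≤length-leaves-block a b c)

  -- The default d is only reached on the empty list.
  rightComb : V → List V → Term V
  rightComb d []           = var d
  rightComb d (x ∷ [])     = var x
  rightComb d (x ∷ y ∷ ys) = var x · rightComb d (y ∷ ys)

  leaves-rightComb : ∀ d x xs → leaves (rightComb d (x ∷ xs)) ≡ x ∷ xs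
  leaves-rightComb d x []       = refl
  leaves-rightComb d x (y ∷ ys) = cong (x ∷_) (leaves-rightComb d y ys)

  size-rightComb : ∀ d x xs → size (rightComb d (x ∷ xs)) ≡ suc (length xs)
  size-rightComb d x xs =
    trans (size≡length-leaves (rightComb d (x ∷ xs))) (cong length (leaves-rightComb d x xs))

  rightComb-Core : ∀ {d r} → Admissible (length r) → Core (rightComb d r)
  rightComb-Core {r = x ∷ []}        _ = var x
  rightComb-Core {d} {x ∷ y ∷ z ∷ r} _ = block (var x) (var y) (rightComb d (z ∷ r))
  rightComb-Core {r = []}         (inj₁ ())
  rightComb-Core {r = []}         (inj₂ ())
  rightComb-Core {r = x ∷ y ∷ []} (inj₁ ())
  rightComb-Core {r = x ∷ y ∷ []} (inj₂ (s≤s (s≤s ())))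

eval-local : ∀ {G : Set} (_∙_ : G → G → G) {n} {ρ ρ′ : Fin n → G} t →
             All (λ x → ρ x ≡ ρ′ x) (leaves t) → eval _∙_ ρ t ≡ eval _∙_ ρ′ t
eval-local _∙_ (var x) (eq ∷ []) = eq
eval-local _∙_ (a · b) eqs =
  cong₂ _∙_ (eval-local _∙_ a (All.++⁻ˡ (leaves a) eqs)) (eval-local _∙_ b (All.++⁻ʳ (leaves a) eqs))

-- Normal form under identity (i)

module RightCombNormalForm {G : Set} (_∙_ : G → G → G) (idI : IdentityI _∙_)
                           {n : ℕ} (d : Fin n) (ρ : Fin n → G) where

  ⟦_⟧ : Term (Fin n) → G
  ⟦_⟧ = eval _∙_ ρ

  R : List (Fin n) → G
  R xs = ⟦ rightComb d xs ⟧

  swapʳ : ∀ p q r → p ∙ (q ∙ r) ≡ p ∙ (r ∙ q)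
  swapʳ p q r = proj₁ (idI p q r)

  swapˡ : ∀ p q r → p ∙ (q ∙ r) ≡ q ∙ (p ∙ r)
  swapˡ p q r = trans (proj₁ (idI p q r)) (proj₂ (idI p q r))

  R-∷ : ∀ x xs → 1 ≤ length xs → R (x ∷ xs) ≡ ρ x ∙ R xs
  R-∷ x (y ∷ ys) _ = refl

  private
    ∙R-resp : List (Fin n) → List (Fin n) → Set
    ∙R-resp xs ys = ∀ w → w ∙ R xs ≡ w ∙ R ys

    R-∷-cong : ∀ x {xs ys} → xs ↭ ys → ∙R-resp xs ys → R (x ∷ xs) ≡ R (x ∷ ys)
    R-∷-cong x {[]}    p _ rewrite ↭-empty-inv (↭-sym p) = refl
    R-∷-cong x {_ ∷ _} {[]} p _ with () ← ↭-length p
    R-∷-cong x {_ ∷ _} {_ ∷ _} p eq = eq (ρ x)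

    R-swap : ∀ x y {xs ys} → xs ↭ ys → ∙R-resp xs ys → 1 ≤ length xs →
             R (x ∷ y ∷ xs) ≡ R (y ∷ x ∷ ys)
    R-swap x y {_ ∷ _} {[]} p _ _ with () ← ↭-length p
    R-swap x y {z ∷ xs} {_ ∷ _} p eq _ =
      trans (swapˡ (ρ x) (ρ y) (R (z ∷ xs))) (cong (ρ y ∙_) (eq (ρ x)))

    -- R xs depends only on the multiset xs once length xs ≥ 3, w ∙ R xs already for every xs;
    -- the induction over ↭ needs both.
    R-resp-↭′ : ∀ {xs ys} → xs ↭ ys → ∙R-resp xs ys × (3 ≤ length xs → R xs ≡ R ys)
    R-resp-↭′ ↭.refl = (λ _ → refl) , (λ _ → refl)
    R-resp-↭′ (↭.trans p q) with R-resp-↭′ p | R-resp-↭′ q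
    ... | eqp , Rp | eqq , Rq =
      (λ w → trans (eqp w) (eqq w)) , λ h → trans (Rp h) (Rq (subst (3 ≤_) (↭-length p) h))
    R-resp-↭′ (prep x p) =
      let eq = R-∷-cong x p (proj₁ (R-resp-↭′ p)) in (λ w → cong (w ∙_) eq) , λ _ → eq
    R-resp-↭′ (swap {[]} x y p) rewrite ↭-empty-inv (↭-sym p) =
      (λ w → swapʳ w (ρ x) (ρ y)) , λ { (s≤s (s≤s ())) }
    R-resp-↭′ (swap {_ ∷ _} x y p) =
      let eq = R-swap x y p (proj₁ (R-resp-↭′ p)) (s≤s z≤n) in (λ w → cong (w ∙_) eq) , λ _ → eq

  R-resp-↭ : ∀ {xs ys} → xs ↭ ys → 3 ≤ length xs → R xs ≡ R ys
  R-resp-↭ p = proj₂ (R-resp-↭′ p)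

  BlockNormal : ℕ → Set
  BlockNormal N = ∀ a b c → size (a · (b · c)) ≤ N →
                  ∀ xs → xs ↭ leaves (a · (b · c)) → ⟦ a · (b · c) ⟧ ≡ R xs

  ∙R≡R-++ : ∀ {N} → BlockNormal N → ∀ c ls → size c + length ls ≤ suc N → 3 ≤ length ls →
            ⟦ c ⟧ ∙ R ls ≡ R (leaves c ++ ls)
  ∙R≡R-++ normal c (_ ∷ [])     _ (s≤s ())
  ∙R≡R-++ normal c (_ ∷ _ ∷ []) _ (s≤s (s≤s ()))
  ∙R≡R-++ {N} normal c ls@(l₀ ∷ l₁ ∷ l₂ ∷ ls′) size≤ _ = begin
    ⟦ c ⟧ ∙ (ρ l₀ ∙ (ρ l₁ ∙ R (l₂ ∷ ls′)))   ≡⟨ swapˡ ⟦ c ⟧ (ρ l₀) _ ⟩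
    ρ l₀ ∙ ⟦ c · (var l₁ · rest) ⟧         ≡⟨ cong (ρ l₀ ∙_) (normal c (var l₁) rest size≤′ _ leaves≡) ⟩
    ρ l₀ ∙ R (leaves c ++ l₁ ∷ l₂ ∷ ls′)     ≡⟨ R-∷ l₀ (leaves c ++ l₁ ∷ l₂ ∷ ls′) 1≤length ⟨
    R (l₀ ∷ leaves c ++ l₁ ∷ l₂ ∷ ls′)       ≡⟨ R-resp-↭ (↭-sym (shift l₀ (leaves c) _)) 3≤length ⟩
    R (leaves c ++ ls)                       ∎
    where
      open ≡-Reasoning
      rest = rightComb d (l₂ ∷ ls′)
      size≤′ : size c + (1 + size rest) ≤ N
      size≤′ rewrite size-rightComb d l₂ ls′ | +-suc (size c) (suc (suc (length ls′))) = ≤-pred size≤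
      leaves≡ : leaves c ++ l₁ ∷ l₂ ∷ ls′ ↭ leaves (c · (var l₁ · rest))
      leaves≡ = ↭-reflexive (cong (λ w → leaves c ++ l₁ ∷ w) (sym (leaves-rightComb d l₂ ls′)))
      1≤length : 1 ≤ length (leaves c ++ l₁ ∷ l₂ ∷ ls′)
      1≤length = ≤-trans (s≤s z≤n) (length-++-≤ʳ (l₁ ∷ l₂ ∷ ls′) {leaves c})
      3≤length : 3 ≤ length (l₀ ∷ leaves c ++ l₁ ∷ l₂ ∷ ls′)
      3≤length = s≤s (≤-trans (s≤s (s≤s z≤n)) (length-++-≤ʳ (l₁ ∷ l₂ ∷ ls′) {leaves c}))

  block-normal : ∀ N → BlockNormal N
  block-normal zero a b c size≤ with () ← ≤-trans (1≤size a) (≤-trans (m≤m+n (size a) _) size≤)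
  block-normal (suc N) (var x) (var y) (var z) _ xs p = R-resp-↭ (↭-sym p) (s≤s (s≤s (s≤s z≤n)))
  block-normal (suc N) (var x) b (e₁ · e₂) size≤ xs p = begin
    ρ x ∙ ⟦ b · (e₁ · e₂) ⟧  ≡⟨ cong (ρ x ∙_) (block-normal N b e₁ e₂ (≤-pred size≤) _ ↭-refl) ⟩
    ρ x ∙ R ls              ≡⟨ R-∷ x ls (≤-trans (1≤length-leaves b) (length-++-≤ˡ (leaves b))) ⟨
    R (x ∷ ls)              ≡⟨ R-resp-↭ (↭-sym p) (3≤length-leaves-block (var x) b (e₁ · e₂)) ⟩
    R xs                    ∎
    where
      open ≡-Reasoning
      ls = leaves b ++ leaves (e₁ · e₂)
  block-normal (suc N) (var x) b@(b₁ · b₂) (var z) size≤ xs p = begin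
    ρ x ∙ (⟦ b ⟧ ∙ ρ z)     ≡⟨ swapʳ (ρ x) ⟦ b ⟧ (ρ z) ⟩
    ρ x ∙ ⟦ var z · b ⟧     ≡⟨ cong (ρ x ∙_) (block-normal N (var z) b₁ b₂ size≤′ _ ↭-refl) ⟩
    R (x ∷ z ∷ leaves b)   ≡⟨ R-resp-↭ (↭-trans (prep x (∷↭∷ʳ z (leaves b))) (↭-sym p))
                                        (s≤s (s≤s (1≤length-leaves b))) ⟩
    R xs                   ∎
    where
      open ≡-Reasoning
      size≤′ : suc (size b) ≤ N
      size≤′ = subst (_≤ N) (+-comm (size b) 1) (≤-pred size≤)
  block-normal (suc N) a@(a₁ · a₂) b c size≤ xs p = begin
    ⟦ a ⟧ ∙ (⟦ b ⟧ ∙ ⟦ c ⟧)  ≡⟨ swapˡ ⟦ a ⟧ ⟦ b ⟧ ⟦ c ⟧ ⟩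
    ⟦ b ⟧ ∙ (⟦ a ⟧ ∙ ⟦ c ⟧)  ≡⟨ swapʳ ⟦ b ⟧ ⟦ a ⟧ ⟦ c ⟧ ⟩
    ⟦ b ⟧ ∙ ⟦ c · a ⟧        ≡⟨ cong (⟦ b ⟧ ∙_) (block-normal N c a₁ a₂ size≤₁ _ ↭-refl) ⟩
    ⟦ b ⟧ ∙ R ls             ≡⟨ ∙R≡R-++ (block-normal N) b ls size≤₂ (3≤length-leaves-block c a₁ a₂) ⟩
    R (leaves b ++ ls)       ≡⟨ R-resp-↭ (↭-sym p′) (3≤length-leaves-block b c a) ⟩
    R xs                     ∎
    where
      open ≡-Reasoning
      ls = leaves c ++ leaves a
      sa sb sc : ℕ
      sa = size a
      sb = size b
      sc = size c
      rotate : sa + (sb + sc) ≡ sb + (sc + sa)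
      rotate = trans (+-comm sa (sb + sc)) (+-assoc sb sc sa)
      size≤₁ : sc + sa ≤ N
      size≤₁ = ≤-pred (≤-trans (+-monoˡ-≤ (sc + sa) (1≤size b)) (subst (_≤ suc N) rotate size≤))
      size≤₂ : sb + length ls ≤ suc N
      size≤₂ = subst (_≤ suc N) (trans rotate (cong (sb +_) (size≡length-leaves (c · a)))) size≤
      p′ : xs ↭ leaves b ++ ls
      p′ = ↭-trans p (↭-trans (++-comm (leaves a) (leaves b ++ leaves c))
                               (↭-reflexive (++-assoc (leaves b) (leaves c) (leaves a))))

  Core-normal : ∀ {u} → Core u → ∀ xs → xs ↭ leaves u → ⟦ u ⟧ ≡ R xs
  Core-normal (var x)       xs p rewrite ↭-singleton-inv p = refl
  Core-normal (block a b c) xs p = block-normal _ a b c ≤-refl xs p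

  ⟦appendVars⟧-cong : ∀ {u u′} zs → ⟦ u ⟧ ≡ ⟦ u′ ⟧ → ⟦ appendVars u zs ⟧ ≡ ⟦ appendVars u′ zs ⟧
  ⟦appendVars⟧-cong []       eq = eq
  ⟦appendVars⟧-cong (z ∷ zs) eq = cong (_∙ ρ z) (⟦appendVars⟧-cong zs eq)

sameOp-normal : ∀ {G : Set} (_∙_ : G → G → G) → IdentityI _∙_ → ∀ {n} (d : Fin n) t xs →
                xs ↭ leaves (core t) → SameOp _∙_ t (appendVars (rightComb d xs) (trailing t))
sameOp-normal _∙_ idI d t xs p ρ = begin
  ⟦ t ⟧                                   ≡⟨ cong ⟦_⟧ (appendVars-core-trailing t) ⟨
  ⟦ appendVars (core t) (trailing t) ⟧    ≡⟨ ⟦appendVars⟧-cong (trailing t) (Core-normal (core-Core t) xs p) ⟩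
  ⟦ appendVars (rightComb d xs) (trailing t) ⟧ ∎
  where
    open ≡-Reasoning
    open RightCombNormalForm _∙_ idI d ρ

-- Representatives of the operations

module Representatives (m : ℕ) where

  N : ℕ
  N = suc m

  vars : List (Fin N)
  vars = allFin N

  length-vars : length vars ≡ N
  length-vars = length-tabulate (λ i → i)

  -- Trailing length m leaves a one-variable core, those below m ∸ 1 a core with at least three
  -- leaves; this is where the terms N! and N P k (k ≤ N ∸ 3) of acBound N come from.
  trailingLengths : List ℕ
  trailingLengths = m ∷ upTo (m ∸ 1)

  ∈-trailingLengths⁻ : ∀ {k r} → r + k ≡ N → k ∈ trailingLengths → Admissible r
  ∈-trailingLengths⁻ {k} {r} eq (here refl) = inj₁ (+-cancelʳ-≡ m r 1 eq)
  ∈-trailingLengths⁻ {k} {r} eq (there k∈)  = inj₂ (k<m∸1⇒3≤r m k r eq (∈-upTo⁻ k∈))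

  ∈-trailingLengths⁺ : ∀ {k r} → r + k ≡ N → Admissible r → k ∈ trailingLengths
  ∈-trailingLengths⁺ {k} {r} eq (inj₁ refl) = here (suc-injective eq)
  ∈-trailingLengths⁺ {k} {r} eq (inj₂ 3≤r)  = there (∈-upTo⁺ (3≤r⇒k<m∸1 m k r eq 3≤r))

  -- (zs , r): trailing variables zs and the leaves r of the core.
  Shape : Set
  Shape = List (Fin N) × List (Fin N)

  shapesOfTrailingLength : ℕ → List Shape
  shapesOfTrailingLength k = injSeqs k vars

  shapes : List Shape
  shapes = concatMap shapesOfTrailingLength trailingLengths

  rep : Shape → Term (Fin N)
  rep (zs , r) = appendVars (rightComb zero r) zs

  length-shapes : length shapes ≡ acBound N
  length-shapes = begin
    length shapes
      ≡⟨ length-concatMap shapesOfTrailingLength trailingLengths ⟩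
    length (injSeqs m vars) + sum (map (length ∘ shapesOfTrailingLength) (upTo (m ∸ 1)))
      ≡⟨ cong₂ _+_ (trans (length-injSeqs m vars) (trans (cong (_P m) length-vars) (suc-P≡! m)))
                   (cong sum (map-cong (λ k → trans (length-injSeqs k vars) (cong (_P k) length-vars))
                                       (upTo (m ∸ 1)))) ⟩
    acBound N
      ∎
    where open ≡-Reasoning

  shape-sound : ∀ {zs r} → (zs , r) ∈ shapes → vars ↭ r ++ zs × Admissible (length r)
  shape-sound {zs} {r} s∈ with find (∈-concatMap⁻ shapesOfTrailingLength {xs = trailingLengths} s∈)
  ... | k , k∈ , s∈′ with injSeqs-sound k vars s∈′
  ... | vars↭ , refl = vars↭ , ∈-trailingLengths⁻ total k∈
    where
      total : length r + length zs ≡ N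
      total = trans (sym (length-++ r)) (trans (sym (↭-length vars↭)) length-vars)

  leaves-rep : ∀ zs x r → leaves (rep (zs , x ∷ r)) ≡ x ∷ r ++ reverse zs
  leaves-rep zs x r =
    trans (leaves-appendVars (rightComb zero (x ∷ r)) zs) (cong (_++ reverse zs) (leaves-rightComb zero x r))

  rep-linear : ∀ {s} → s ∈ shapes → IsFullLinear N (rep s)
  rep-linear {zs , []} s∈ with proj₂ (shape-sound s∈)
  ... | inj₁ ()
  ... | inj₂ ()
  rep-linear {zs , x ∷ r} s∈ =
    subst (_↭ vars) (sym (leaves-rep zs x r))
      (↭-trans (++⁺ˡ (x ∷ r) (↭-reverse zs)) (↭-sym (proj₁ (shape-sound s∈))))

  trailing-rep : ∀ {s} → s ∈ shapes → trailing (rep s) ≡ proj₁ s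
  trailing-rep {zs , r} s∈ = trailing-appendVars (rightComb-Core (proj₂ (shape-sound s∈))) zs

  trailingLengths-unique : Unique trailingLengths
  trailingLengths-unique = All.tabulate m∉ ∷ upTo⁺ (m ∸ 1)
    where
      m∉ : ∀ {j} → j ∈ upTo (m ∸ 1) → m ≢ j
      m∉ j∈ refl = 1+n≰n (≤-trans (∈-upTo⁻ j∈) (m∸n≤m m 1))

  shapes-distinct : AllPairs (λ s s′ → proj₁ s ≢ proj₁ s′) shapes
  shapes-distinct =
    AllPairs-concatMap⁺ shapesOfTrailingLength
      (All.tabulate λ {k} _ → injSeqs-distinct k (allFin⁺ N))
      (AllPairs.map different-lengths trailingLengths-unique)
    where
      different-lengths : ∀ {k k′} → k ≢ k′ → ∀ {s s′} → s ∈ injSeqs k vars → s′ ∈ injSeqs k′ vars →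
                          proj₁ s ≢ proj₁ s′
      different-lengths k≢k′ s∈ s′∈ eq =
        k≢k′ (trans (sym (proj₂ (injSeqs-sound _ vars s∈)))
                    (trans (cong length eq) (proj₂ (injSeqs-sound _ vars s′∈))))

  coreLengths : List ℕ
  coreLengths = 1 ∷ map (3 +_) (upTo (m ∸ 1))

  CoreLength : ℕ → Set
  CoreLength c = c ≤ N × Admissible c

  coreLengths-sound : All CoreLength coreLengths
  coreLengths-sound = (s≤s z≤n , inj₁ refl) ∷ All.map⁺ (All.tabulate sound)
    where
      sound : ∀ {j} → j ∈ upTo (m ∸ 1) → CoreLength (3 + j)
      sound j∈ = j<m∸1⇒3+j≤1+m m (∈-upTo⁻ j∈) , inj₂ (s≤s (s≤s (s≤s z≤n)))

  ∈-coreLengths : ∀ {c} → CoreLength c → c ∈ coreLengths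
  ∈-coreLengths (_ , inj₁ refl) = here refl
  ∈-coreLengths {suc (suc (suc j))} (c≤N , inj₂ _) = there (∈-map⁺ (3 +_) (∈-upTo⁺ (∸-monoˡ-≤ 2 c≤N)))
  ∈-coreLengths {1} (_ , inj₂ (s≤s ()))
  ∈-coreLengths {2} (_ , inj₂ (s≤s (s≤s ())))

  coreLengths-unique : Unique coreLengths
  coreLengths-unique =
    All.map⁺ (All.tabulate (λ _ ())) ∷
    AllPairs.map⁺ (AllPairs.map (λ j≢ eq → j≢ (+-cancelˡ-≡ 3 _ _ eq)) (upTo⁺ (m ∸ 1)))

  length-coreLengths : 1 ≤ m → length coreLengths ≡ m
  length-coreLengths (s≤s _) = cong suc (trans (length-map (3 +_) (upTo (m ∸ 1))) (length-upTo (m ∸ 1)))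

  bracketRep : ℕ → Term (Fin N)
  bracketRep c = rep (reverse (drop c vars) , take c vars)

  bracketRep-bracketing : ∀ {c} → CoreLength c → IsBracketing N (bracketRep c)
  bracketRep-bracketing {zero} (_ , inj₂ ())
  bracketRep-bracketing {suc c} _ = begin
    leaves (bracketRep (suc c))                              ≡⟨ leaves-rep (reverse (drop (suc c) vars)) zero _ ⟩
    take (suc c) vars ++ reverse (reverse (drop (suc c) vars)) ≡⟨ cong (take (suc c) vars ++_)
                                                                       (reverse-involutive _) ⟩
    take (suc c) vars ++ drop (suc c) vars                   ≡⟨ take++drop≡id (suc c) vars ⟩
    vars                                                     ∎
    where open ≡-Reasoning

  length-trailing-bracketRep : ∀ {c} → CoreLength c → length (trailing (bracketRep c)) ≡ N ∸ c
  length-trailing-bracketRep {c} (c≤N , admissible) = begin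
    length (trailing (bracketRep c))  ≡⟨ cong length (trailing-appendVars (rightComb-Core {d = zero} admissible′)
                                                                          (reverse (drop c vars))) ⟩
    length (reverse (drop c vars))    ≡⟨ length-reverse (drop c vars) ⟩
    length (drop c vars)              ≡⟨ length-drop c vars ⟩
    length vars ∸ c                   ≡⟨ cong (_∸ c) length-vars ⟩
    N ∸ c                             ∎
    where
      open ≡-Reasoning
      admissible′ : Admissible (length (take c vars))
      admissible′ = subst Admissible
        (sym (trans (length-take c vars) (trans (cong (c ⊓_) length-vars) (m≤n⇒m⊓n≡m c≤N)))) admissible

  bracketing-core : ∀ t → IsBracketing N t → let c = length (leaves (core t)) in
                    CoreLength c × bracketRep c ≡ appendVars (rightComb zero (leaves (core t))) (trailing t)
  bracketing-core t bracketing = (lu≤N , length-leaves-Core (core-Core t)) , bracketRep≡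
    where
      lu = leaves (core t)
      zs = trailing t
      vars≡ : vars ≡ lu ++ reverse zs
      vars≡ = trans (sym bracketing) (leaves-core-trailing t)
      lu≤N : length lu ≤ N
      lu≤N = subst (length lu ≤_) (trans (cong length (sym vars≡)) length-vars) (length-++-≤ˡ lu)
      bracketRep≡ : bracketRep (length lu) ≡ appendVars (rightComb zero lu) zs
      bracketRep≡ = cong₂ (λ r zs′ → appendVars (rightComb zero r) zs′)
        (trans (cong (take (length lu)) vars≡) (take-length-++ lu (reverse zs)))
        (trans (cong (reverse ∘ drop (length lu)) vars≡)
               (trans (cong reverse (drop-length-++ lu (reverse zs))) (reverse-involutive zs)))

module Bounds {G : Set} (_∙_ : G → G → G) (idI : IdentityI _∙_) (m : ℕ) where
  open Representatives m

  _≈_ : Term (Fin N) → Term (Fin N) → Set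
  _≈_ = SameOp _∙_

  ≈-sym : ∀ {s t} → s ≈ t → t ≈ s
  ≈-sym s≈t ρ = sym (s≈t ρ)

  ≈-trans : ∀ {s t u} → s ≈ t → t ≈ u → s ≈ u
  ≈-trans s≈t t≈u ρ = trans (s≈t ρ) (t≈u ρ)

  open Covering _≈_ (λ {s t} → ≈-sym {s} {t}) (λ {s t u} → ≈-trans {s} {t} {u})

  shape-of : ∀ t → IsFullLinear N t → Σ Shape λ s → s ∈ shapes × t ≈ rep s × proj₁ s ≡ trailing t
  shape-of t linear = shape (injSeqs-complete zs vars↭)
    where
      lu = leaves (core t)
      zs = trailing t
      vars↭ : vars ↭ lu ++ zs
      vars↭ = ↭-trans (↭-sym linear)
                (↭-trans (↭-reflexive (leaves-core-trailing t)) (++⁺ˡ lu (↭-reverse zs)))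
      zs∈ : length zs ∈ trailingLengths
      zs∈ = ∈-trailingLengths⁺ (trans (sym (length-++ lu)) (trans (sym (↭-length vars↭)) length-vars))
                                (length-leaves-Core (core-Core t))
      shape : Σ (List (Fin N)) (λ r → (zs , r) ∈ injSeqs (length zs) vars × r ↭ lu) →
              Σ Shape λ s → s ∈ shapes × t ≈ rep s × proj₁ s ≡ zs
      shape (r , s∈ , r↭) =
        (zs , r) , ∈-concatMap⁺ shapesOfTrailingLength (lose zs∈ s∈) , sameOp-normal _∙_ idI zero t r r↭ , refl

  acReps : List (Term (Fin N))
  acReps = map rep shapes

  length-acReps : length acReps ≡ acBound N
  length-acReps = trans (length-map rep shapes) length-shapes

  acReps-cover : ∀ t → IsFullLinear N t → Any (t ≈_) acReps
  acReps-cover t linear with shape-of t linear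
  ... | s , s∈ , t≈ , _ = Any.map⁺ (lose s∈ t≈)

  sac≤acBound : sacAtMost _∙_ N (acBound N)
  sac≤acBound = acReps , All.map⁺ (All.tabulate rep-linear) , ≤-reflexive length-acReps , acReps-cover

  trailing-separates : sacIs _∙_ N (acBound N) → ∀ {t t′} → IsFullLinear N t → IsFullLinear N t′ →
                       trailing t ≢ trailing t′ → ¬ t ≈ t′
  trailing-separates (L , linearL , lengthL , inequivalentL , _) {t} {t′} lt lt′ tr≢ t≈t′
    with shape-of t lt | shape-of t′ lt′
  ... | s , s∈ , t≈s , tr-s | s′ , s′∈ , t′≈s′ , tr-s′ =
    tight-cover-inequivalent inequivalentL (All.tabulate λ {x} x∈ → acReps-cover x (All.lookup linearL x∈))
      (≤-reflexive (trans length-acReps (sym lengthL))) (∈-map⁺ rep s∈) (∈-map⁺ rep s′∈) reps≢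
      (λ ρ → trans (sym (t≈s ρ)) (trans (t≈t′ ρ) (t′≈s′ ρ)))
    where
      reps≢ : rep s ≢ rep s′
      reps≢ eq = tr≢ (begin
        trailing t          ≡⟨ tr-s ⟨
        proj₁ s             ≡⟨ trailing-rep s∈ ⟨
        trailing (rep s)    ≡⟨ cong trailing eq ⟩
        trailing (rep s′)   ≡⟨ trailing-rep s′∈ ⟩
        proj₁ s′            ≡⟨ tr-s′ ⟩
        trailing t′         ∎)
        where open ≡-Reasoning

  bracketReps : List (Term (Fin N))
  bracketReps = map bracketRep coreLengths

  bracketReps-cover : ∀ t → IsBracketing N t → Any (t ≈_) bracketReps
  bracketReps-cover t bracketing with bracketing-core t bracketing
  ... | coreLength , bracketRep≡ =
    Any.map⁺ (lose (∈-coreLengths coreLength)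
      (subst (t ≈_) (sym bracketRep≡) (sameOp-normal _∙_ idI zero t (leaves (core t)) ↭-refl)))

  s≤m : 1 ≤ m → sAtMost _∙_ N m
  s≤m 1≤m = bracketReps , All.map⁺ (All.map bracketRep-bracketing coreLengths-sound) ,
            ≤-reflexive (trans (length-map bracketRep coreLengths) (length-coreLengths 1≤m)) ,
            bracketReps-cover

  sac≡acBound⇒s≡m : 1 ≤ m → sacIs _∙_ N (acBound N) → sIs _∙_ N m
  sac≡acBound⇒s≡m 1≤m sac =
    bracketReps , All.map⁺ (All.map bracketRep-bracketing coreLengths-sound) ,
    trans (length-map bracketRep coreLengths) (length-coreLengths 1≤m) ,
    AllPairs.map⁺ (AllPairs-strengthen separated coreLengths-sound coreLengths-unique) , bracketReps-cover
    where
      linear : ∀ {c} → CoreLength c → IsFullLinear N (bracketRep c)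
      linear cl = ↭-reflexive (bracketRep-bracketing cl)
      separated : ∀ {c c′} → CoreLength c → CoreLength c′ → c ≢ c′ → ¬ bracketRep c ≈ bracketRep c′
      separated {c} {c′} cl cl′ c≢c′ =
        trailing-separates sac {bracketRep c} {bracketRep c′} (linear cl) (linear cl′) λ eq →
          c≢c′ (∸-cancelˡ-≡ (proj₁ cl) (proj₁ cl′)
            (trans (sym (length-trailing-bracketRep cl))
                   (trans (cong length eq) (length-trailing-bracketRep cl′))))

-- SC367

one two : Fin 3
one = suc zero
two = suc (suc zero)

x∙0≡0 : ∀ x → sc367 x zero ≡ zero
x∙0≡0 zero             = refl
x∙0≡0 (suc zero)       = refl
x∙0≡0 (suc (suc zero)) = refl

x∙1≡0 : ∀ x → sc367 x one ≡ zero
x∙1≡0 zero             = refl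
x∙1≡0 (suc zero)       = refl
x∙1≡0 (suc (suc zero)) = refl

x∙yz≡0 : ∀ x y z → sc367 x (sc367 y z) ≡ zero
x∙yz≡0 x zero    zero             = x∙0≡0 x
x∙yz≡0 x zero    (suc zero)       = x∙0≡0 x
x∙yz≡0 x zero    (suc (suc zero)) = x∙1≡0 x
x∙yz≡0 x (suc y) z                = x∙0≡0 x

sc367-identityI : IdentityI sc367
sc367-identityI x y z = trans (x∙yz≡0 x y z) (sym (x∙yz≡0 x z y)) , trans (x∙yz≡0 x z y) (sym (x∙yz≡0 y x z))

Separated : Fin 3 → Fin 3 → Set
Separated a b = (a ≡ zero × b ≡ one) ⊎ (a ≡ one × b ≡ zero)

Separated-sym : ∀ {a b} → Separated a b → Separated b a
Separated-sym (inj₁ (a≡ , b≡)) = inj₂ (b≡ , a≡)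
Separated-sym (inj₂ (a≡ , b≡)) = inj₁ (b≡ , a≡)

Separated-∙2 : ∀ {a b} → Separated a b → Separated (sc367 a two) (sc367 b two)
Separated-∙2 (inj₁ (refl , refl)) = inj₂ (refl , refl)
Separated-∙2 (inj₂ (refl , refl)) = inj₁ (refl , refl)

Separated⇒≢ : ∀ {a b} → Separated a b → a ≢ b
Separated⇒≢ (inj₁ (refl , refl)) ()
Separated⇒≢ (inj₂ (refl , refl)) ()

module SC367Separation {n : ℕ} where

  ⟦_⟧_ : Term (Fin n) → (Fin n → Fin 3) → Fin 3
  ⟦ t ⟧ ρ = eval sc367 ρ t

  ⟦⟧-zero : ∀ t → ⟦ t ⟧ (λ _ → zero) ≡ zero
  ⟦⟧-zero (var x) = refl
  ⟦⟧-zero (a · b) rewrite ⟦⟧-zero a | ⟦⟧-zero b = refl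

  _[_↦2] : (Fin n → Fin 3) → Fin n → Fin n → Fin 3
  ρ [ z ↦2] = updateAt ρ z (λ _ → two)

  ⟦⟧-↦2-away : ∀ ρ z t → All (z ≢_) (leaves t) → ⟦ t ⟧ (ρ [ z ↦2]) ≡ ⟦ t ⟧ ρ
  ⟦⟧-↦2-away ρ z t z∉t = eval-local sc367 t (All.map (λ z≢x → updateAt-minimal _ z ρ (z≢x ∘ sym)) z∉t)

  ⟦⟧-mark : ∀ z t → All (z ≢_) (leaves t) → ⟦ t ⟧ ((λ _ → zero) [ z ↦2]) ≡ zero
  ⟦⟧-mark z t z∉t = trans (⟦⟧-↦2-away (λ _ → zero) z t z∉t) (⟦⟧-zero t)

  private
    separate-[] : ∀ {u} u′ zs z → Core u → Unique (leaves (appendVars u′ zs) ∷ʳ z) →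
                  length (leaves u) ≡ suc (length (leaves (appendVars u′ zs))) →
                  Σ (Fin n → Fin 3) λ ρ → Separated (⟦ u ⟧ ρ) (⟦ appendVars u′ zs · var z ⟧ ρ)
    separate-[] u′ zs z (var x) _ eq
      with () ← subst (1 ≤_) (sym (suc-injective eq)) (1≤length-leaves (appendVars u′ zs))
    separate-[] u′ zs z (block a b c) uniq _ =
      (λ _ → zero) [ z ↦2] ,
      inj₁ (x∙yz≡0 _ _ _ ,
            cong₂ sc367 (⟦⟧-mark z (appendVars u′ zs) (proj₁ (Unique-∷ʳ⁻ uniq))) (updateAt-updates z _))

  -- At the outermost position where zs and zs′ differ, give the variable of one side the value 2 and
  -- all others 0: that side becomes 0 ∙ 2 = 1, the other x ∙ 0 = 0 (a block u(vw) is always 0).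
  -- Each common variable further out, set to 2, just swaps 0 and 1.
  separate : ∀ {u u′} zs zs′ → Core u → Core u′ →
             Unique (leaves (appendVars u zs)) → Unique (leaves (appendVars u′ zs′)) →
             length (leaves (appendVars u zs)) ≡ length (leaves (appendVars u′ zs′)) → zs ≢ zs′ →
             Σ (Fin n → Fin 3) λ ρ → Separated (⟦ appendVars u zs ⟧ ρ) (⟦ appendVars u′ zs′ ⟧ ρ)
  separate []       []        _  _   _    _     _  zs≢ = ⊥-elim (zs≢ refl)
  separate {u′ = u′} [] (z′ ∷ bs) cu _ _ uniq′ eq _ =
    separate-[] u′ bs z′ cu uniq′ (trans eq (length-++-comm (leaves (appendVars u′ bs)) (z′ ∷ [])))
  separate {u} (z ∷ as) [] _ cu′ uniq _ eq _ =
    map₂ Separated-sym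
      (separate-[] u as z cu′ uniq (trans (sym eq) (length-++-comm (leaves (appendVars u as)) (z ∷ []))))
  separate {u} {u′} (z ∷ as) (z′ ∷ bs) cu cu′ uniq uniq′ eq zs≢ with z Data.Fin.≟ z′
  ... | yes refl with separate as bs cu cu′ (proj₂ (Unique-∷ʳ⁻ uniq)) (proj₂ (Unique-∷ʳ⁻ uniq′))
                        (suc-injective (trans (sym (length-++-comm (leaves (appendVars u as)) (z ∷ [])))
                                        (trans eq (length-++-comm (leaves (appendVars u′ bs)) (z ∷ [])))))
                        (zs≢ ∘ cong (z ∷_))
  ...   | ρ , sep = ρ [ z ↦2] ,
    subst₂ Separated
      (cong₂ sc367 (sym (⟦⟧-↦2-away ρ z (appendVars u as) (proj₁ (Unique-∷ʳ⁻ uniq))))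
                   (sym (updateAt-updates z ρ)))
      (cong₂ sc367 (sym (⟦⟧-↦2-away ρ z (appendVars u′ bs) (proj₁ (Unique-∷ʳ⁻ uniq′))))
                   (sym (updateAt-updates z ρ)))
      (Separated-∙2 sep)
  separate {u} {u′} (z ∷ as) (z′ ∷ bs) cu cu′ uniq uniq′ eq zs≢ | no z≢z′ =
    (λ _ → zero) [ z ↦2] ,
    inj₂ (cong₂ sc367 (⟦⟧-mark z (appendVars u as) (proj₁ (Unique-∷ʳ⁻ uniq))) (updateAt-updates z _) ,
          trans (cong (sc367 _) (updateAt-minimal z′ z _ (z≢z′ ∘ sym))) (x∙0≡0 _))

module SC367Spectra (m : ℕ) where
  open Representatives m
  open Bounds sc367 sc367-identityI m
  open SC367Separation

  unique-leaves : ∀ t → IsFullLinear N t → Unique (leaves t)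
  unique-leaves _ linear = Unique-resp-↭ (↭-sym linear) (allFin⁺ N)

  reps-separated : ∀ {s s′} → s ∈ shapes → s′ ∈ shapes → proj₁ s ≢ proj₁ s′ → ¬ rep s ≈ rep s′
  reps-separated {zs , r} {zs′ , r′} s∈ s′∈ zs≢ rep≈ with
    separate zs zs′ (rightComb-Core (proj₂ (shape-sound s∈))) (rightComb-Core (proj₂ (shape-sound s′∈)))
      (unique-leaves (rep (zs , r)) (rep-linear s∈)) (unique-leaves (rep (zs′ , r′)) (rep-linear s′∈))
      (trans (↭-length (rep-linear s∈)) (sym (↭-length (rep-linear s′∈)))) zs≢
  ... | ρ , sep = Separated⇒≢ sep (rep≈ ρ)

  sac≡acBound : sacIs sc367 N (acBound N)
  sac≡acBound =
    acReps , proj₁ (proj₂ sac≤acBound) , length-acReps ,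
    AllPairs.map⁺ (AllPairs-strengthen reps-separated (All.tabulate (λ s∈ → s∈)) shapes-distinct) ,
    acReps-cover

-- Mirror images and SC10

tabulate-∷ʳ : ∀ {A : Set} n (f : Fin (suc n) → A) → tabulate f ≡ tabulate (f ∘ inject₁) ∷ʳ f (fromℕ n)
tabulate-∷ʳ zero    f = refl
tabulate-∷ʳ (suc n) f = cong (f zero ∷_) (tabulate-∷ʳ n (f ∘ suc))

reverse-map-opposite-allFin : ∀ n → reverse (map opposite (allFin n)) ≡ allFin n
reverse-map-opposite-allFin zero    = refl
reverse-map-opposite-allFin (suc n) = begin
  reverse (fromℕ n ∷ map opposite (tabulate suc))
    ≡⟨ cong (reverse ∘ (fromℕ n ∷_)) opposite-suc ⟩
  reverse (fromℕ n ∷ map inject₁ opposites)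
    ≡⟨ unfold-reverse (fromℕ n) (map inject₁ opposites) ⟩
  reverse (map inject₁ opposites) ∷ʳ fromℕ n
    ≡⟨ cong (_∷ʳ fromℕ n) (reverse-map inject₁ opposites) ⟨
  map inject₁ (reverse opposites) ∷ʳ fromℕ n
    ≡⟨ cong (λ xs → map inject₁ xs ∷ʳ fromℕ n) (reverse-map-opposite-allFin n) ⟩
  map inject₁ (allFin n) ∷ʳ fromℕ n
    ≡⟨ cong (_∷ʳ fromℕ n) (map-tabulate (λ i → i) inject₁) ⟩
  tabulate inject₁ ∷ʳ fromℕ n
    ≡⟨ tabulate-∷ʳ n (λ i → i) ⟨
  allFin (suc n)
    ∎
  where
    open ≡-Reasoning
    opposites = map opposite (allFin n)
    opposite-suc : map opposite (tabulate suc) ≡ map inject₁ opposites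
    opposite-suc = trans (map-tabulate suc opposite)
                         (sym (trans (cong (map inject₁) (map-tabulate (λ i → i) opposite))
                                     (map-tabulate opposite inject₁)))

module Mirror {n : ℕ} where

  mirror : Term (Fin n) → Term (Fin n)
  mirror (var x) = var (opposite x)
  mirror (s · t) = mirror t · mirror s

  mirror-involutive : ∀ t → mirror (mirror t) ≡ t
  mirror-involutive (var x) = cong var (opposite-involutive x)
  mirror-involutive (s · t) = cong₂ _·_ (mirror-involutive s) (mirror-involutive t)

  leaves-mirror : ∀ t → leaves (mirror t) ≡ reverse (map opposite (leaves t))
  leaves-mirror (var x) = refl
  leaves-mirror (s · t) = begin
    leaves (mirror t) ++ leaves (mirror s)
      ≡⟨ cong₂ _++_ (leaves-mirror t) (leaves-mirror s) ⟩
    reverse (map opposite (leaves t)) ++ reverse (map opposite (leaves s))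
      ≡⟨ reverse-++ (map opposite (leaves s)) (map opposite (leaves t)) ⟨
    reverse (map opposite (leaves s) ++ map opposite (leaves t))
      ≡⟨ cong reverse (map-++ opposite (leaves s) (leaves t)) ⟨
    reverse (map opposite (leaves (s · t)))
      ∎
    where open ≡-Reasoning

  mirror-bracketing : ∀ t → IsBracketing n t → IsBracketing n (mirror t)
  mirror-bracketing t bracketing =
    trans (leaves-mirror t) (trans (cong (reverse ∘ map opposite) bracketing) (reverse-map-opposite-allFin n))

  mirror-linear : ∀ t → IsFullLinear n t → IsFullLinear n (mirror t)
  mirror-linear t linear = subst (_↭ allFin n) (sym (leaves-mirror t))
    (↭-trans (↭-reverse (map opposite (leaves t)))
      (↭-trans (↭ₚ.map⁺ opposite linear)
        (↭-trans (↭-sym (↭-reverse (map opposite (allFin n)))) (↭-reflexive (reverse-map-opposite-allFin n)))))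

  module _ {G : Set} {_∙_ _∘′_ : G → G → G} (opposite-op : ∀ a b → a ∘′ b ≡ b ∙ a) where

    eval-mirror : ∀ ρ t → eval _∘′_ ρ t ≡ eval _∙_ (ρ ∘ opposite) (mirror t)
    eval-mirror ρ (var x) = cong ρ (sym (opposite-involutive x))
    eval-mirror ρ (s · t) = trans (opposite-op _ _) (cong₂ _∙_ (eval-mirror ρ t) (eval-mirror ρ s))

    sameOp-mirror : ∀ s t → SameOp _∙_ (mirror s) (mirror t) → SameOp _∘′_ s t
    sameOp-mirror s t same ρ = trans (eval-mirror ρ s) (trans (same (ρ ∘ opposite)) (sym (eval-mirror ρ t)))

  SpecIs-opposite : ∀ {G : Set} {_∙_ _∘′_ : G → G → G} → (∀ a b → a ∘′ b ≡ b ∙ a) →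
                    ∀ {Q : Term (Fin n) → Set} {k} → (∀ t → Q t → Q (mirror t)) →
                    SpecIs _∙_ Q k → SpecIs _∘′_ Q k
  SpecIs-opposite {_∙_ = _∙_} {_∘′_} opposite-op closed (L , QL , lengthL , inequivalentL , coverL) =
    map mirror L ,
    All.map⁺ (All.map (λ {t} → closed t) QL) ,
    trans (length-map mirror L) lengthL ,
    AllPairs.map⁺ (AllPairs.map (λ {s} {t} s≉t same → s≉t (sameOp-mirror opposite-op′ s t same)) inequivalentL) ,
    λ t Qt → Any.map⁺ (Any.map (λ {e} same → sameOp-mirror opposite-op t (mirror e)
                                  (subst (SameOp _∙_ (mirror t)) (sym (mirror-involutive e)) same))
                                (coverL (mirror t) (closed t Qt)))
    where
      opposite-op′ : ∀ a b → a ∙ b ≡ b ∘′ a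
      opposite-op′ a b = sym (opposite-op b a)

sc10≡flip-sc367 : ∀ a b → sc10 a b ≡ sc367 b a
sc10≡flip-sc367 zero             b       = sym (x∙0≡0 b)
sc10≡flip-sc367 (suc zero)       b       = sym (x∙1≡0 b)
sc10≡flip-sc367 (suc (suc zero)) zero    = refl
sc10≡flip-sc367 (suc (suc zero)) (suc b) = refl

module _ {G : Set} (_∙_ : G → G → G) (idI : IdentityI _∙_) where

  sAtMost-n∸1 : ∀ n → 2 ≤ n → sAtMost _∙_ n (n ∸ 1)
  sAtMost-n∸1 (suc (suc m)) _ = Bounds.s≤m _∙_ idI (suc m) (s≤s z≤n)
  sAtMost-n∸1 (suc zero) (s≤s ())

  sacAtMost-acBound : ∀ n → 1 ≤ n → sacAtMost _∙_ n (acBound n)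
  sacAtMost-acBound (suc m) _ = Bounds.sac≤acBound _∙_ idI m

  sacIs-acBound⇒sIs-n∸1 : ∀ n → 2 ≤ n → sacIs _∙_ n (acBound n) → sIs _∙_ n (n ∸ 1)
  sacIs-acBound⇒sIs-n∸1 (suc (suc m)) _ = Bounds.sac≡acBound⇒s≡m _∙_ idI (suc m) (s≤s z≤n)
  sacIs-acBound⇒sIs-n∸1 (suc zero) (s≤s ())

sc367-sacIs : ∀ n → 1 ≤ n → sacIs sc367 n (acBound n)
sc367-sacIs (suc m) _ = SC367Spectra.sac≡acBound m

sc367-sIs : ∀ n → 2 ≤ n → sIs sc367 n (n ∸ 1)
sc367-sIs n 2≤n =
  sacIs-acBound⇒sIs-n∸1 sc367 sc367-identityI n 2≤n (sc367-sacIs n (≤-trans (s≤s z≤n) 2≤n))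

proposition4p2 :
    ((G : Set) (_∙_ : G → G → G) → IdentityI _∙_ → IdentityII _∙_ →
      ((n : ℕ) → 2 ≤ n → sAtMost _∙_ n (n ∸ 1))
      × ((n : ℕ) → 1 ≤ n → sacAtMost _∙_ n (acBound n))
      × ((n : ℕ) → 2 ≤ n → sacIs _∙_ n (acBound n) → sIs _∙_ n (n ∸ 1)))
    × (((n : ℕ) → 2 ≤ n → sIs sc367 n (n ∸ 1))
      × ((n : ℕ) → 1 ≤ n → sacIs sc367 n (acBound n)))
    × (((n : ℕ) → 2 ≤ n → sIs sc10 n (n ∸ 1))
      × ((n : ℕ) → 1 ≤ n → sacIs sc10 n (acBound n)))
proposition4p2 =
  (λ G _∙_ idI _ → sAtMost-n∸1 _∙_ idI , sacAtMost-acBound _∙_ idI , sacIs-acBound⇒sIs-n∸1 _∙_ idI) ,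
  (sc367-sIs , sc367-sacIs) ,
  ((λ n 2≤n → SpecIs-opposite sc10≡flip-sc367 mirror-bracketing (sc367-sIs n 2≤n)) ,
   (λ n 1≤n → SpecIs-opposite sc10≡flip-sc367 mirror-linear (sc367-sacIs n 1≤n)))
  where open Mirror
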